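{- Let $1\le k\le\ell$ and $s\ge1$ be integers. If $\mathbf{c}\in\mathbb{N}^\ell$ satisfies $c_j\le s$ for all $j$ and $|\mathbf{c}|=ks$, then $((s^k),\mathbf{c})\in\widetilde{\mathcal{D}}(k,\ell)$, where $(s^k)=(s,\dots,s)\in\mathbb{N}^k$.
   Context: $\mathbb{N}=\{1,2,\dots\}$, $\mathbb{N}_0=\mathbb{N}\cup\{0\}$; for a tuple $\mathbf{x}$, $|\mathbf{x}|$ is the sum of its entries. For $\mathbf{r}\in\mathbb{N}_0^r$ and $\mathbf{s}\in\mathbb{N}_0^s$, $\mathcal{A}(\mathbf{r},\mathbf{s})$ is the set of $r\times s$ matrices with entries in $\{0,1\}$ whose row-sum vector is $\mathbf{r}$ and column-sum vector is $\mathbf{s}$. For $k,\ell\in\mathbb{N}$, $\widetilde{\mathcal{D}}(k,\ell)$ is the set of pairs $(\mathbf{m},\mathbf{n})\in\mathbb{N}^k\times\mathbb{N}^\ell$ for which there exist $t\in\mathbb{N}$, $\mathbf{r}\in\mathbb{N}_0^t$, $V\in\mathcal{A}(\mathbf{r},\mathbf{m})$ and $W\in\mathcal{A}(\mathbf{r},\mathbf{n})$ such that every entry of $V^\top W$ is a positive integer. -}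

module Defs where

open import Data.Nat using (ℕ; zero; suc; _+_; _*_; _≤_; _<_)
open import Data.Bool using (Bool; true; false)
open import Data.Fin using (Fin)
open import Data.Product using (Σ; ∃; _×_; _,_)
open import Relation.Binary.PropositionalEquality using (_≡_)

∑ : (n : ℕ) → (Fin n → ℕ) → ℕ
∑ zero    x = 0
∑ (suc n) x = x Fin.zero + ∑ n (λ i → x (Fin.suc i))
  where import Data.Fin as Fin

-- ℕ-tuples (positive entries): N^n
Positive : (n : ℕ) → (Fin n → ℕ) → Set
Positive n x = (i : Fin n) → 1 ≤ x i

val : Bool → ℕ
val true  = 1
val false = 0

Mat01 : ℕ → ℕ → Set
Mat01 r s = Fin r → Fin s → Bool

InA : (r s : ℕ) → (Fin r → ℕ) → (Fin s → ℕ) → Mat01 r s → Set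
InA r s rv sv M =
  ((i : Fin r) → ∑ s (λ j → val (M i j)) ≡ rv i) ×
  ((j : Fin s) → ∑ r (λ i → val (M i j)) ≡ sv j)

VtW : (t k l : ℕ) → Mat01 t k → Mat01 t l → Fin k → Fin l → ℕ
VtW t k l V W a b = ∑ t (λ i → val (V i a) * val (W i b))

InDtilde : (k l : ℕ) → (Fin k → ℕ) → (Fin l → ℕ) → Set
InDtilde k l m n =
  Positive k m × Positive l n ×
  Σ ℕ λ t → 1 ≤ t × Σ (Fin t → ℕ) λ r →
    Σ (Mat01 t k) λ V → Σ (Mat01 t l) λ W →
      InA t k r m V × InA t l r n W ×
      ((a : Fin k) (b : Fin l) → 1 ≤ VtW t k l V W a b)

-- Take s rows, let V be the all-ones s × k matrix and fill W column by
-- column, column j receiving c_j ones in consecutive rows read cyclically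
-- modulo s, each column starting where the previous one stopped.  Since
-- c_j ≤ s, no column meets a row twice, so W is a 0/1 matrix with column sums
-- c; since |c| = ks, the filling winds around exactly k times, so every row of
-- W sums to k, as does every row of V.  Then (VᵀW)_{ab} is the b-th column sum
-- c_b ≥ 1.
module Submission where

open import Defs
open import Data.Nat using (ℕ; _*_; _≤_)
open import Data.Fin using (Fin)
open import Relation.Binary.PropositionalEquality using (_≡_)

open import Data.Bool using (Bool; true; false)
open import Data.Empty using (⊥-elim)
open import Data.Fin using (toℕ) renaming (zero to fzero; suc to fsuc)
open import Data.Fin.Properties using (toℕ<n)
open import Data.Nat using (zero; suc; _+_; _∸_; _<_; _≡ᵇ_; _%_; z≤n; s≤s; NonZero)
open import Data.Nat.DivMod using ([m+n]%n≡m%n; m%n<n; m<n⇒m%n≡m)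
open import Data.Nat.Properties
open import Algebra.Properties.CommutativeSemigroup +-commutativeSemigroup
  using (interchange)
open import Data.Product using (_,_; proj₂)
open import Relation.Binary.PropositionalEquality
  using (_≢_; refl; sym; trans; cong; cong₂; subst; module ≡-Reasoning)
open import Relation.Nullary using (yes; no)
open import Function using (const)

open ≡-Reasoning

∑-cong : ∀ n {f g : Fin n → ℕ} → (∀ i → f i ≡ g i) → ∑ n f ≡ ∑ n g
∑-cong zero    f≗g = refl
∑-cong (suc n) f≗g = cong₂ _+_ (f≗g fzero) (∑-cong n (λ i → f≗g (fsuc i)))

∑-distrib-+ : ∀ n (f g : Fin n → ℕ) → ∑ n (λ i → f i + g i) ≡ ∑ n f + ∑ n g
∑-distrib-+ zero    f g = refl
∑-distrib-+ (suc n) f g =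
  trans (cong (f fzero + g fzero +_) (∑-distrib-+ n (λ i → f (fsuc i)) (λ i → g (fsuc i))))
        (interchange (f fzero) (g fzero) _ _)

∑-const : ∀ n x → ∑ n (λ _ → x) ≡ n * x
∑-const zero    x = refl
∑-const (suc n) x = cong (x +_) (∑-const n x)

∑-zero : ∀ n {f : Fin n → ℕ} → (∀ i → f i ≡ 0) → ∑ n f ≡ 0
∑-zero n f≗0 = trans (∑-cong n f≗0) (trans (∑-const n 0) (*-zeroʳ n))

δ : ℕ → ℕ → ℕ
δ m i = val (m ≡ᵇ i)

δ-refl : ∀ m → δ m m ≡ 1
δ-refl zero    = refl
δ-refl (suc m) = δ-refl m

δ-≢ : ∀ {m i} → m ≢ i → δ m i ≡ 0
δ-≢ {zero}  {zero}  m≢i = ⊥-elim (m≢i refl)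
δ-≢ {zero}  {suc i} m≢i = refl
δ-≢ {suc m} {zero}  m≢i = refl
δ-≢ {suc m} {suc i} m≢i = δ-≢ (λ m≡i → m≢i (cong suc m≡i))

∑-δ : ∀ n {m} → m < n → ∑ n (λ i → δ m (toℕ i)) ≡ 1
∑-δ (suc n) {zero}  _         = cong suc (∑-zero n (λ _ → refl))
∑-δ (suc n) {suc m} (s≤s m<n) = ∑-δ n m<n

toBool : ℕ → Bool
toBool zero    = false
toBool (suc _) = true

val-toBool : ∀ {n} → n ≤ 1 → val (toBool n) ≡ n
val-toBool {zero}        _         = refl
val-toBool {suc zero}    _         = refl
val-toBool {suc (suc n)} (s≤s ())

module CyclicFilling (s : ℕ) .{{_ : NonZero s}} where

  hits : ℕ → ℕ → ℕ → ℕ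
  hits a zero    i = 0
  hits a (suc c) i = δ (a % s) i + hits (suc a) c i

  hits-++ : ∀ a c d i → hits a (c + d) i ≡ hits a c i + hits (a + c) d i
  hits-++ a zero    d i = cong (λ b → hits b d i) (sym (+-identityʳ a))
  hits-++ a (suc c) d i = begin
    δ (a % s) i + hits (suc a) (c + d) i
      ≡⟨ cong (δ (a % s) i +_) (hits-++ (suc a) c d i) ⟩
    δ (a % s) i + (hits (suc a) c i + hits (suc a + c) d i)
      ≡⟨ +-assoc (δ (a % s) i) _ _ ⟨
    hits a (suc c) i + hits (suc a + c) d i
      ≡⟨ cong (λ b → hits a (suc c) i + hits b d i) (+-suc a c) ⟨
    hits a (suc c) i + hits (a + suc c) d i ∎

  hits-mono : ∀ a {c d} i → c ≤ d → hits a c i ≤ hits a d i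
  hits-mono a {c} i c≤d = subst (hits a c i ≤_)
    (trans (sym (hits-++ a c (_ ∸ c) i)) (cong (λ e → hits a e i) (m+[n∸m]≡n c≤d)))
    (m≤m+n _ _)

  ∑-hits : ∀ a c → ∑ s (λ i → hits a c (toℕ i)) ≡ c
  ∑-hits a zero    = ∑-zero s (λ _ → refl)
  ∑-hits a (suc c) =
    trans (∑-distrib-+ s (λ i → δ (a % s) (toℕ i)) (λ i → hits (suc a) c (toℕ i)))
          (cong₂ _+_ (∑-δ s (m%n<n a s)) (∑-hits (suc a) c))

  private
    shift-bound : ∀ b m → b + suc m ≤ s → suc b + m ≤ s
    shift-bound b m = subst (_≤ s) (+-suc b m)

    %-small : ∀ b m → b + suc m ≤ s → b % s ≡ b
    %-small b m le = m<n⇒m%n≡m (m+n≤o⇒m≤o (suc b) (shift-bound b m le))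

  hits-below : ∀ b m i → i < b → b + m ≤ s → hits b m i ≡ 0
  hits-below b zero    i i<b le = refl
  hits-below b (suc m) i i<b le =
    cong₂ _+_ (trans (cong (λ x → δ x i) (%-small b m le)) (δ-≢ (>⇒≢ i<b)))
              (hits-below (suc b) m i (m<n⇒m<1+n i<b) (shift-bound b m le))

  hits-inside : ∀ b m i → b ≤ i → i < b + m → b + m ≤ s → hits b m i ≡ 1
  hits-inside b zero    i b≤i i<b  le = ⊥-elim (<⇒≱ (subst (i <_) (+-identityʳ b) i<b) b≤i)
  hits-inside b (suc m) i b≤i i<b+m le rewrite %-small b m le with b ≟ i
  ... | yes refl = cong₂ _+_ (δ-refl b) (hits-below (suc b) m b ≤-refl (shift-bound b m le))
  ... | no  b≢i  = cong₂ _+_ (δ-≢ b≢i)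
    (hits-inside (suc b) m i (≤∧≢⇒< b≤i b≢i) (subst (i <_) (+-suc b m) i<b+m) (shift-bound b m le))

  -- Sliding the window [a, a + s) by one trades a for a + s ≡ a (mod s).
  hits-period : ∀ a i → i < s → hits a s i ≡ 1
  hits-period zero    i i<s = hits-inside 0 s i z≤n i<s ≤-refl
  hits-period (suc a) i i<s = +-cancelˡ-≡ (δ (a % s) i) _ _ (begin
    hits a (suc s) i                      ≡⟨ cong (λ c → hits a c i) (+-comm 1 s) ⟩
    hits a (s + 1) i                      ≡⟨ hits-++ a s 1 i ⟩
    hits a s i + (δ ((a + s) % s) i + 0)  ≡⟨ cong₂ _+_ (hits-period a i i<s)
                                                       (cong (λ x → δ x i + 0) ([m+n]%n≡m%n a s)) ⟩
    1 + (δ (a % s) i + 0)                 ≡⟨ cong (1 +_) (+-identityʳ _) ⟩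
    1 + δ (a % s) i                       ≡⟨ +-comm 1 _ ⟩
    δ (a % s) i + 1                       ∎)

  hits-periods : ∀ k a i → i < s → hits a (k * s) i ≡ k
  hits-periods zero    a i i<s = refl
  hits-periods (suc k) a i i<s =
    trans (hits-++ a s (k * s) i) (cong₂ _+_ (hits-period a i i<s) (hits-periods k (a + s) i i<s))

  hits≤1 : ∀ a {c i} → c ≤ s → i < s → hits a c i ≤ 1
  hits≤1 a {c} {i} c≤s i<s = subst (hits a c i ≤_) (hits-period a i i<s) (hits-mono a i c≤s)

  starts : ∀ n → (Fin n → ℕ) → ℕ → Fin n → ℕ
  starts (suc n) c a fzero    = a
  starts (suc n) c a (fsuc j) = starts n (λ j → c (fsuc j)) (a + c fzero) j

  ∑-hits-starts : ∀ n (c : Fin n → ℕ) a i →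
    ∑ n (λ j → hits (starts n c a j) (c j) i) ≡ hits a (∑ n c) i
  ∑-hits-starts zero    c a i = refl
  ∑-hits-starts (suc n) c a i =
    trans (cong (hits a (c fzero) i +_) (∑-hits-starts n (λ j → c (fsuc j)) (a + c fzero) i))
          (sym (hits-++ a (c fzero) _ i))

  fill : ∀ l → (Fin l → ℕ) → Mat01 s l
  fill l c i j = toBool (hits (starts l c 0 j) (c j) (toℕ i))

  fill-∈A : ∀ k l (c : Fin l → ℕ) → (∀ j → c j ≤ s) → ∑ l c ≡ k * s →
    InA s l (const k) c (fill l c)
  fill-∈A k l c c≤s ∑c≡ks = row-sums , column-sums
    where
    val-fill : ∀ i j → val (fill l c i j) ≡ hits (starts l c 0 j) (c j) (toℕ i)
    val-fill i j = val-toBool (hits≤1 _ (c≤s j) (toℕ<n i))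

    row-sums : ∀ i → ∑ l (λ j → val (fill l c i j)) ≡ k
    row-sums i = begin
      ∑ l (λ j → val (fill l c i j))                   ≡⟨ ∑-cong l (val-fill i) ⟩
      ∑ l (λ j → hits (starts l c 0 j) (c j) (toℕ i))  ≡⟨ ∑-hits-starts l c 0 (toℕ i) ⟩
      hits 0 (∑ l c) (toℕ i)                           ≡⟨ cong (λ n → hits 0 n (toℕ i)) ∑c≡ks ⟩
      hits 0 (k * s) (toℕ i)                           ≡⟨ hits-periods k 0 (toℕ i) (toℕ<n i) ⟩
      k                                                ∎

    column-sums : ∀ j → ∑ s (λ i → val (fill l c i j)) ≡ c j
    column-sums j = trans (∑-cong s (λ i → val-fill i j)) (∑-hits _ (c j))

allOnes : ∀ t k → Mat01 t k
allOnes t k _ _ = true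

allOnes-∈A : ∀ t k → InA t k (const k) (const t) (allOnes t k)
allOnes-∈A t k =
  (λ _ → trans (∑-const k 1) (*-identityʳ k)) , (λ _ → trans (∑-const t 1) (*-identityʳ t))

VtW-allOnes : ∀ t k l (W : Mat01 t l) a b → VtW t k l (allOnes t k) W a b ≡ ∑ t (λ i → val (W i b))
VtW-allOnes t k l W a b = ∑-cong t (λ i → *-identityˡ (val (W i b)))

lemma2p5 : (k l s : ℕ) → 1 ≤ k → k ≤ l → 1 ≤ s →
    (c : Fin l → ℕ) → Positive l c → ((j : Fin l) → c j ≤ s) →
    ∑ l c ≡ k * s →
    InDtilde k l (λ _ → s) c
lemma2p5 k l zero      _ _ () c c-pos c≤s ∑c≡ks
lemma2p5 k l s@(suc _) _ _ _  c c-pos c≤s ∑c≡ks =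
  (λ _ → s≤s z≤n) , c-pos , s , s≤s z≤n , const k , allOnes s k , fill l c ,
  allOnes-∈A s k , W∈A , VᵀW-positive
  where
  open CyclicFilling s

  W∈A : InA s l (const k) c (fill l c)
  W∈A = fill-∈A k l c c≤s ∑c≡ks

  VᵀW-positive : ∀ a b → 1 ≤ VtW s k l (allOnes s k) (fill l c) a b
  VᵀW-positive a b =
    subst (1 ≤_) (sym (trans (VtW-allOnes s k l (fill l c) a b) (proj₂ W∈A b))) (c-pos b)
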